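{- Let $D=(G,\mathcal{O},w)$ be a weighted oriented graph and $K$ a weighted oriented subgraph of $D$. Suppose either $H$ is a root oriented tree contained in $K$ with parent $v$ that is maximal (under inclusion) among root oriented trees contained in $K$ with parent $v$, or $H$ is a unicycle oriented subgraph contained in $K$ with cycle $C$ that is maximal among unicycle oriented subgraphs contained in $K$ with cycle $C$. Then there is no $(y,x)\in E(K)$ with $x\in V(K)\setminus V(H)$ and $y\in V^{+}\cap V(H)$.
   Context: A weighted oriented graph is a triple $D=(G,\mathcal{O},w)$ with $G$ a finite simple graph, $\mathcal{O}$ an orientation of its edges, $w:V(G)\to\mathbb{N}$; $E(D)$ is the set of oriented edges. $V^{+}=\{x\mid w(x)>1\}$. Standing convention: every source (vertex with no incoming edge) has weight $1$. A weighted oriented subgraph of $D$ is an oriented subgraph of $(G,\mathcal{O})$ with weights restricted from $w$; $E(K)$ is its set of oriented edges, $\deg_H(x)$ the number of neighbours of $x$ in $H$. Oriented path: distinct $(y_1,\dots,y_m)$ with $(y_i,y_{i+1})$ oriented edges; oriented cycle: such a path closed by the oriented edge $(y_m,y_1)$. A unicycle oriented subgraph is a weighted oriented subgraph $B$ of $D$ with exactly one cycle $C$ such that $C$ is an oriented cycle, every $y\in V(B)\setminus V(C)$ is reached by an oriented path in $B$ from a vertex of $C$, and $w(x)=1\Rightarrow\deg_B(x)=1$ for $x\in V(B)$. A root oriented tree with parent $v$ is a weighted oriented subgraph $T$ of $D$ without cycles, with $v\in V(T)$, such that every $x\in V(T)\setminus\{v\}$ is reached by an oriented path in $T$ from $v$,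 and if $x\in V(T)$ has $w(x)=1$ then ($\deg_T(x)=1$ and $x\ne v$) or ($V(T)=\{v\}$ and $x=v$). -}

module Defs where

open import Data.Nat using (ℕ; _≤_; _<_)
open import Data.Bool using (Bool; true; false; _∨_)
open import Data.Fin using (Fin)
open import Data.List using (List; []; _∷_; _++_; length; filterᵇ; allFin)
open import Data.List.Relation.Unary.Unique.Propositional using (Unique)
open import Data.List.Relation.Unary.Linked using (Linked)
open import Data.List.Membership.Propositional using (_∈_)
open import Data.Product using (Σ; ∃; _×_)
open import Data.Sum using (_⊎_)
open import Relation.Nullary using (¬_)
open import Relation.Binary.PropositionalEquality using (_≡_; _≢_)
open import Function.Bundles using (_⇔_)

-- The simple graph G together
-- with its orientation O is encoded by the arc relation: arc x y = true iff
-- {x,y} ∈ E(G) oriented as (x,y).  Simplicity: no loops, and at most one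
-- orientation per pair.
record WOG (n : ℕ) : Set where
  field
    arc      : Fin n → Fin n → Bool
    irrefl   : ∀ x → arc x x ≡ false
    asym     : ∀ x y → arc x y ≡ true → arc y x ≡ false
    w        : Fin n → ℕ
    w-pos    : ∀ x → 1 ≤ w x
    source-w : ∀ x → (∀ y → arc y x ≡ false) → w x ≡ 1
open WOG public

-- Weighted oriented subgraph of D (weights are those of D).
record Sub {n : ℕ} (D : WOG n) : Set where
  field
    V     : Fin n → Bool
    E     : Fin n → Fin n → Bool
    E⊆arc : ∀ x y → E x y ≡ true → arc D x y ≡ true
    E⊆V   : ∀ x y → E x y ≡ true → (V x ≡ true × V y ≡ true)
open Sub public

module _ {n : ℕ} {D : WOG n} where

  _⊆ₛ_ : Sub D → Sub D → Set
  H ⊆ₛ H' = (∀ x → V H x ≡ true → V H' x ≡ true)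
          × (∀ x y → E H x y ≡ true → E H' x y ≡ true)

  OArc : Sub D → Fin n → Fin n → Set
  OArc H x y = E H x y ≡ true

  Adj : Sub D → Fin n → Fin n → Set
  Adj H x y = E H x y ≡ true ⊎ E H y x ≡ true

  deg : Sub D → Fin n → ℕ
  deg H x = length (filterᵇ (λ z → E H x z ∨ E H z x) (allFin n))

-- R-path of distinct vertices x = y₁, …, y_m = y (here m ≥ 2)
Path : {n : ℕ} → (Fin n → Fin n → Set) → Fin n → Fin n → Set
Path {n} R x y = Σ (List (Fin n)) λ mid →
  Unique (x ∷ mid ++ y ∷ []) × Linked R (x ∷ mid ++ y ∷ [])

CycleList : {n : ℕ} → (Fin n → Fin n → Set) → Fin n → List (Fin n) → Set
CycleList R x rest =
  2 ≤ length rest × Unique (x ∷ rest) × Linked R (x ∷ rest ++ x ∷ [])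

data Consec {A : Set} : List A → A → A → Set where
  here  : ∀ {a b l} → Consec (a ∷ b ∷ l) a b
  there : ∀ {c a b l} → Consec l a b → Consec (c ∷ l) a b

module _ {n : ℕ} {D : WOG n} where

  IsOrientedCycle : Sub D → Set
  IsOrientedCycle C = Σ (Fin n) λ x → Σ (List (Fin n)) λ rest →
      CycleList (λ a b → arc D a b ≡ true) x rest
    × (∀ z → (V C z ≡ true) ⇔ (z ∈ x ∷ rest))
    × (∀ a b → (E C a b ≡ true) ⇔ Consec (x ∷ rest ++ x ∷ []) a b)

  IsUnicycle : Sub D → Sub D → Set
  IsUnicycle B C =
      IsOrientedCycle C
    × C ⊆ₛ B
    -- C is the only cycle of B: every cycle of (the underlying graph of) B
    -- has exactly the edge set of C
    × (∀ x rest → CycleList (Adj B) x rest → ∀ a b →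
          (Consec (x ∷ rest ++ x ∷ []) a b ⊎ Consec (x ∷ rest ++ x ∷ []) b a)
          ⇔ (E C a b ≡ true ⊎ E C b a ≡ true))
    × (∀ y → V B y ≡ true → V C y ≡ false →
          Σ (Fin n) λ c → V C c ≡ true × Path (OArc B) c y)
    × (∀ x → V B x ≡ true → w D x ≡ 1 → deg B x ≡ 1)

  IsRootTree : Sub D → Fin n → Set
  IsRootTree T v =
      (∀ x rest → ¬ CycleList (Adj T) x rest)
    × V T v ≡ true
    × (∀ x → V T x ≡ true → x ≢ v → Path (OArc T) v x)
    × (∀ x → V T x ≡ true → w D x ≡ 1 →
          (deg T x ≡ 1 × x ≢ v)
          ⊎ ((∀ z → (V T z ≡ true) ⇔ (z ≡ v)) × x ≡ v))

  MaxRootTreeIn : Sub D → Fin n → Sub D → Set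
  MaxRootTreeIn K v H =
      IsRootTree H v × H ⊆ₛ K
    × (∀ H' → IsRootTree H' v → H' ⊆ₛ K → H ⊆ₛ H' → H' ⊆ₛ H)

  MaxUnicycleIn : Sub D → Sub D → Sub D → Set
  MaxUnicycleIn K C H =
      IsUnicycle H C × H ⊆ₛ K
    × (∀ H' → IsUnicycle H' C → H' ⊆ₛ K → H ⊆ₛ H' → H' ⊆ₛ H)

-- Add to H the vertex x and the arc (y , x). In the enlarged subgraph x is a leaf whose only
-- neighbour is y, so x lies on no cycle (every vertex of a cycle has two distinct neighbours along
-- it); hence its cycles are those of H, and acyclicity, resp. uniqueness of the cycle, is inherited.
-- Oriented paths reaching y extend by the new arc to x. Since w(y) > 1, every vertex of weight 1
-- keeps its degree, except x itself, which has degree 1. So the enlarged subgraph is again a root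
-- oriented tree with parent v, resp. a unicycle subgraph with cycle C, inside K, and strictly
-- larger than H, contradicting maximality.
module Submission where

open import Defs
open import Data.Nat using (ℕ; _<_; _≤_; s≤s; suc)
open import Data.Nat.Properties using (<-irrefl; suc-injective)
open import Data.Bool using (Bool; true; false; T; T?; _∨_; _∧_)
open import Data.Bool.Properties using (∨-identityʳ; ∨-zeroʳ; ∧-identityʳ; ∧-zeroʳ)
open import Data.Fin using (Fin; _≟_)
open import Data.List using ([]; _∷_; _++_; length; filterᵇ; allFin; initLast; _∷ʳ′_)
open import Data.List.Properties using (++-assoc; filter-≐)
open import Data.List.Relation.Unary.All as All using (All; []; _∷_)
open import Data.List.Relation.Unary.All.Properties as All using (¬Any⇒All¬)
open import Data.List.Relation.Unary.Any using (here; there)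
open import Data.List.Relation.Unary.AllPairs using ([]; _∷_)
open import Data.List.Relation.Unary.Unique.Propositional using (Unique)
open import Data.List.Relation.Unary.Unique.Propositional.Properties as Unique using (allFin⁺)
open import Data.List.Relation.Unary.Linked as Linked using (Linked; []; [-]; _∷_)
open import Data.List.Membership.Propositional using (_∈_; _∉_)
open import Data.List.Membership.Propositional.Properties using (∈-allFin; ∈-∃++; ∈-insert)
open import Data.Product as Product using (Σ; ∃-syntax; _×_; _,_; proj₁; proj₂; map₁; map₂)
open import Data.Sum as Sum using (_⊎_; inj₁; inj₂)
open import Function using (_∘_)
open import Function.Bundles using (Equivalence; _⇔_)
open import Relation.Nullary using (¬_; yes; no; does; contradiction)
open import Relation.Nullary.Decidable using (dec-true; dec-false)
open import Relation.Binary.PropositionalEquality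
  using (_≡_; _≢_; refl; sym; trans; cong; cong₂; subst; ≢-sym; setoid)

module _ {A : Set} {R : A → A → Set} where

  Linked-split : ∀ xs {y ys} → Linked R (xs ++ y ∷ ys) → Linked R (xs ++ y ∷ []) × Linked R (y ∷ ys)
  Linked-split []           l        = [-] , l
  Linked-split (_ ∷ [])     (r ∷ l)  = r ∷ [-] , l
  Linked-split (_ ∷ b ∷ xs) (r ∷ l)  = map₁ (r ∷_) (Linked-split (b ∷ xs) l)

  Linked-join : ∀ xs {y ys} → Linked R (xs ++ y ∷ []) → Linked R (y ∷ ys) → Linked R (xs ++ y ∷ ys)
  Linked-join []           _        l = l
  Linked-join (_ ∷ [])     (r ∷ _)  l = r ∷ l
  Linked-join (_ ∷ b ∷ xs) (r ∷ l′) l = r ∷ Linked-join (b ∷ xs) l′ l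

  Linked-restrict : ∀ {P : A → Set} {S : A → A → Set} → (∀ {a b} → P a → P b → R a b → S a b) →
                    ∀ {xs} → All P xs → Linked R xs → Linked S xs
  Linked-restrict f _              []       = []
  Linked-restrict f _              [-]      = [-]
  Linked-restrict f (pa ∷ pb ∷ ps) (r ∷ rs) = f pa pb r ∷ Linked-restrict f (pb ∷ ps) rs

  Linked-propagate : ∀ {P : A → Set} → (∀ {a b} → R a b → P a → P b) →
                     ∀ {a xs} → P a → Linked R (a ∷ xs) → All P (a ∷ xs)
  Linked-propagate f pa [-]      = pa ∷ []
  Linked-propagate f pa (r ∷ rs) = pa ∷ Linked-propagate f (f r pa) rs

module _ {n : ℕ} {R : Fin n → Fin n → Set} where

  open import Data.List.Relation.Binary.Permutation.Setoid (setoid (Fin n)) using (_↭_)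
  open import Data.List.Relation.Binary.Permutation.Setoid.Properties (setoid (Fin n))
    using (++-comm; Unique-resp-↭; xs↭ys⇒|xs|≡|ys|)

  CycleList-rotate : ∀ {x₀ z rest} → CycleList R x₀ rest → z ∈ x₀ ∷ rest →
                     ∃[ rest′ ] CycleList R z rest′
  CycleList-rotate {rest = rest} cyc z∈ with ∈-∃++ z∈
  ... | [] , _ , refl = rest , cyc
  CycleList-rotate {x₀} {z} (len , uniq , closed) _ | _ ∷ pre , post , refl =
    post ++ x₀ ∷ pre , len′ , Unique-resp-↭ rotation uniq , closed′
    where
      rotation : x₀ ∷ pre ++ z ∷ post ↭ z ∷ post ++ x₀ ∷ pre
      rotation = ++-comm (x₀ ∷ pre) (z ∷ post)
      len′ : 2 ≤ length (post ++ x₀ ∷ pre)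
      len′ = subst (2 ≤_) (suc-injective (xs↭ys⇒|xs|≡|ys| rotation)) len
      halves : Linked R (x₀ ∷ pre ++ z ∷ []) × Linked R (z ∷ post ++ x₀ ∷ [])
      halves = Linked-split (x₀ ∷ pre)
                 (subst (Linked R ∘ (x₀ ∷_)) (++-assoc pre (z ∷ post) (x₀ ∷ [])) closed)
      closed′ : Linked R (z ∷ (post ++ x₀ ∷ pre) ++ z ∷ [])
      closed′ = subst (Linked R ∘ (z ∷_)) (sym (++-assoc post (x₀ ∷ pre) (z ∷ [])))
                  (Linked-join (z ∷ post) (proj₂ halves) (proj₁ halves))

  CycleList-head-neighbours : ∀ {z rest} → CycleList R z rest →
                              ∃[ a ] ∃[ b ] a ≢ b × R a z × R z b
  CycleList-head-neighbours {rest = []} (() , _)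
  CycleList-head-neighbours {z} {b ∷ rest} (len , _ ∷ b∉ ∷ _ , z→b ∷ closed)
    with initLast rest
  ... | [] = contradiction len λ { (s≤s ()) }
  ... | mid ∷ʳ′ a =
    a , b , ≢-sym (All.lookup b∉ (∈-insert mid)) ,
    Linked.head (proj₂ (Linked-split (b ∷ mid)
      (subst (Linked R ∘ (b ∷_)) (++-assoc mid (a ∷ []) (z ∷ [])) closed))) , z→b

  CycleList-avoids-pendant : ∀ {x y x₀ rest} → (∀ {a} → R a x → a ≡ y) → (∀ {b} → R x b → b ≡ y) →
                             CycleList R x₀ rest → x ∉ x₀ ∷ rest
  CycleList-avoids-pendant into out cyc x∈
    with _ , _ , a≢b , a→x , x→b ← CycleList-head-neighbours (proj₂ (CycleList-rotate cyc x∈))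
    = a≢b (trans (into a→x) (sym (out x→b)))

  Path-edge : ∀ {c x} → c ≢ x → R c x → Path R c x
  Path-edge c≢x r = [] , (c≢x ∷ []) ∷ [] ∷ [] , r ∷ [-]

  Path-snoc : ∀ {c y x} (p : Path R c y) → x ∉ c ∷ proj₁ p ++ y ∷ [] → R y x → Path R c x
  Path-snoc {c} {y} {x} (mid , uniq , linked) x∉ r =
    mid ++ y ∷ [] ,
    Unique.++⁺ uniq ([] ∷ []) (λ { (x∈ , here refl) → x∉ x∈ }) ,
    subst (Linked R ∘ (c ∷_)) (sym (++-assoc mid (y ∷ []) (x ∷ [])))
      (Linked-join (c ∷ mid) linked (r ∷ [-]))

Path-map : ∀ {n} {R S : Fin n → Fin n → Set} → (∀ {a b} → R a b → S a b) →
           ∀ {c z} → Path R c z → Path S c z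
Path-map f (mid , uniq , linked) = mid , uniq , Linked.map f linked

filterᵇ-cong : ∀ {A : Set} {f g : A → Bool} → (∀ u → f u ≡ g u) → ∀ xs → filterᵇ f xs ≡ filterᵇ g xs
filterᵇ-cong {f = f} {g} f≗g =
  filter-≐ (T? ∘ f) (T? ∘ g) ((λ {u} → subst T (f≗g u)) , (λ {u} → subst T (sym (f≗g u))))

module _ {n : ℕ} {y : Fin n} where

  length-filter-≟-∉ : ∀ {xs} → y ∉ xs → length (filterᵇ (λ u → does (u ≟ y)) xs) ≡ 0
  length-filter-≟-∉ {[]}     _  = refl
  length-filter-≟-∉ {u ∷ xs} y∉ with u ≟ y
  ... | yes refl = contradiction (here refl) y∉
  ... | no _     = length-filter-≟-∉ (y∉ ∘ there)

  length-filter-≟-unique : ∀ {xs} → Unique xs → y ∈ xs → length (filterᵇ (λ u → does (u ≟ y)) xs) ≡ 1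
  length-filter-≟-unique {u ∷ xs} (u∉ ∷ _) y∈ with u ≟ y
  length-filter-≟-unique (u∉ ∷ _) _         | yes refl =
    cong suc (length-filter-≟-∉ (λ y∈ → All.lookup u∉ y∈ refl))
  length-filter-≟-unique _        (here refl) | no u≢y  = contradiction refl u≢y
  length-filter-≟-unique (_ ∷ uq) (there y∈)  | no _    = length-filter-≟-unique uq y∈

module _ {n : ℕ} {D : WOG n} where

  neighbourᵇ : Sub D → Fin n → Fin n → Bool
  neighbourᵇ H z u = E H z u ∨ E H u z

  deg-cong : ∀ {H H′ : Sub D} {z z′} → (∀ u → neighbourᵇ H z u ≡ neighbourᵇ H′ z′ u) →
             deg H z ≡ deg H′ z′
  deg-cong same = cong length (filterᵇ-cong same (allFin n))

  deg≡1 : ∀ {H : Sub D} {z y} → (∀ u → neighbourᵇ H z u ≡ does (u ≟ y)) → deg H z ≡ 1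
  deg≡1 {y = y} only-y =
    trans (cong length (filterᵇ-cong only-y (allFin n)))
          (length-filter-≟-unique (allFin⁺ n) (∈-allFin y))

  E-at-nonvertexˡ : ∀ (H : Sub D) {x} → V H x ≡ false → ∀ u → E H x u ≡ false
  E-at-nonvertexˡ H {x} x∉H u with E H x u in xu
  ... | true  = contradiction (trans (sym (proj₁ (E⊆V H x u xu))) x∉H) λ ()
  ... | false = refl

  E-at-nonvertexʳ : ∀ (H : Sub D) {x} → V H x ≡ false → ∀ u → E H u x ≡ false
  E-at-nonvertexʳ H {x} x∉H u with E H u x in ux
  ... | true  = contradiction (trans (sym (proj₂ (E⊆V H u x ux))) x∉H) λ ()
  ... | false = refl

  ⊆ₛ-trans : ∀ {H₁ H₂ H₃ : Sub D} → H₁ ⊆ₛ H₂ → H₂ ⊆ₛ H₃ → H₁ ⊆ₛ H₃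
  ⊆ₛ-trans (V₁₂ , E₁₂) (V₂₃ , E₂₃) = (λ z → V₂₃ z ∘ V₁₂ z) , (λ a b → E₂₃ a b ∘ E₁₂ a b)

module PendantArc {n : ℕ} {D : WOG n} (H : Sub D) {y x : Fin n}
                  (y→x : arc D y x ≡ true) (y∈H : V H y ≡ true) (x∉H : V H x ≡ false) where

  ∈H⇒≢x : ∀ {z} → V H z ≡ true → z ≢ x
  ∈H⇒≢x z∈H refl = contradiction (trans (sym z∈H) x∉H) λ ()

  V⁺ : Fin n → Bool
  V⁺ z = V H z ∨ does (z ≟ x)

  E⁺ : Fin n → Fin n → Bool
  E⁺ a b = E H a b ∨ (does (a ≟ y) ∧ does (b ≟ x))

  x∈V⁺ : V⁺ x ≡ true
  x∈V⁺ = trans (cong (V H x ∨_) (dec-true (x ≟ x) refl)) (∨-zeroʳ _)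

  V⁺-cases : ∀ {z} → V⁺ z ≡ true → V H z ≡ true ⊎ z ≡ x
  V⁺-cases {z} z∈ with V H z | z ≟ x
  ... | true  | _        = inj₁ refl
  ... | false | yes refl = inj₂ refl
  V⁺-cases () | false | no _

  E⁺-cases : ∀ {a b} → E⁺ a b ≡ true → E H a b ≡ true ⊎ (a ≡ y × b ≡ x)
  E⁺-cases {a} {b} ab with E H a b | a ≟ y | b ≟ x
  ... | true  | _        | _        = inj₁ refl
  ... | false | yes refl | yes refl = inj₂ (refl , refl)
  E⁺-cases () | false | no _     | _
  E⁺-cases () | false | yes refl | no _

  H⁺ : Sub D
  H⁺ = record { V = V⁺ ; E = E⁺ ; E⊆arc = E⁺⊆arc ; E⊆V = E⁺⊆V }
    where
      E⁺⊆arc : ∀ a b → E⁺ a b ≡ true → arc D a b ≡ true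
      E⁺⊆arc a b ab with E⁺-cases ab
      ... | inj₁ ab∈H          = E⊆arc H a b ab∈H
      ... | inj₂ (refl , refl) = y→x
      E⁺⊆V : ∀ a b → E⁺ a b ≡ true → V⁺ a ≡ true × V⁺ b ≡ true
      E⁺⊆V a b ab with E⁺-cases ab
      ... | inj₁ ab∈H          = Product.map (cong (_∨ _)) (cong (_∨ _)) (E⊆V H a b ab∈H)
      ... | inj₂ (refl , refl) = cong (_∨ _) y∈H , x∈V⁺

  H⊆H⁺ : H ⊆ₛ H⁺
  H⊆H⁺ = (λ _ → cong (_∨ _)) , (λ _ _ → cong (_∨ _))

  H⁺⊆ : ∀ K → H ⊆ₛ K → E K y x ≡ true → H⁺ ⊆ₛ K
  H⁺⊆ K (V⊆ , E⊆) y→x∈K = V⁺⊆ , E⁺⊆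
    where
      V⁺⊆ : ∀ z → V⁺ z ≡ true → V K z ≡ true
      V⁺⊆ z z∈ with V⁺-cases z∈
      ... | inj₁ z∈H = V⊆ z z∈H
      ... | inj₂ refl = proj₂ (E⊆V K y x y→x∈K)
      E⁺⊆ : ∀ a b → E⁺ a b ≡ true → E K a b ≡ true
      E⁺⊆ a b ab with E⁺-cases ab
      ... | inj₁ ab∈H = E⊆ a b ab∈H
      ... | inj₂ (refl , refl) = y→x∈K

  y→x∈H⁺ : E⁺ y x ≡ true
  y→x∈H⁺ = trans (cong₂ (λ p q → E H y x ∨ (p ∧ q)) (dec-true (y ≟ y) refl) (dec-true (x ≟ x) refl))
                 (∨-zeroʳ _)

  adj⁺-x : ∀ {a} → Adj H⁺ a x → a ≡ y
  adj⁺-x {a} (inj₁ ax) with E⁺-cases ax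
  ... | inj₁ ax∈H      = contradiction (trans (sym ax∈H) (E-at-nonvertexʳ H x∉H a)) λ ()
  ... | inj₂ (a≡y , _) = a≡y
  adj⁺-x {a} (inj₂ xa) with E⁺-cases xa
  ... | inj₁ xa∈H      = contradiction (trans (sym xa∈H) (E-at-nonvertexˡ H x∉H a)) λ ()
  ... | inj₂ (x≡y , _) = contradiction (sym x≡y) (∈H⇒≢x y∈H)

  E⁺⇒E : ∀ {a b} → x ≢ b → E⁺ a b ≡ true → E H a b ≡ true
  E⁺⇒E x≢b ab with E⁺-cases ab
  ... | inj₁ ab∈H      = ab∈H
  ... | inj₂ (_ , b≡x) = contradiction (sym b≡x) x≢b

  Adj⁺⇒Adj : ∀ {a b} → x ≢ a → x ≢ b → Adj H⁺ a b → Adj H a b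
  Adj⁺⇒Adj x≢a x≢b = Sum.map (E⁺⇒E x≢b) (E⁺⇒E x≢a)

  CycleList⁺⇒CycleList : ∀ {x₀ rest} → CycleList (Adj H⁺) x₀ rest → CycleList (Adj H) x₀ rest
  CycleList⁺⇒CycleList {x₀} {rest} cyc@(len , uniq , closed) =
    len , uniq , Linked-restrict Adj⁺⇒Adj (All.++⁺ avoids (All.head avoids ∷ [])) closed
    where
      avoids : All (x ≢_) (x₀ ∷ rest)
      avoids = ¬Any⇒All¬ _ (CycleList-avoids-pendant adj⁺-x (adj⁺-x ∘ Sum.swap) cyc)

  Path⁺ : ∀ {c z} → Path (OArc H) c z → Path (OArc H⁺) c z
  Path⁺ = Path-map (cong (_∨ _))

  Path⁺-to-x : ∀ {c} → V H c ≡ true → c ≡ y ⊎ Path (OArc H) c y → Path (OArc H⁺) c x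
  Path⁺-to-x _   (inj₁ refl) = Path-edge (∈H⇒≢x y∈H) y→x∈H⁺
  Path⁺-to-x {c} c∈H (inj₂ p@(_ , _ , linked)) = Path-snoc (Path⁺ p) x∉p y→x∈H⁺
    where
      x∉p : x ∉ c ∷ proj₁ p ++ y ∷ []
      x∉p x∈ = ∈H⇒≢x (All.lookup (Linked-propagate (λ r _ → proj₂ (E⊆V H _ _ r)) c∈H linked) x∈) refl

  deg⁺-x : deg H⁺ x ≡ 1
  deg⁺-x = deg≡1 {H = H⁺} only-y
    where
      only-y : ∀ u → neighbourᵇ H⁺ x u ≡ does (u ≟ y)
      only-y u rewrite E-at-nonvertexˡ H x∉H u | E-at-nonvertexʳ H x∉H u
                     | dec-false (x ≟ y) (≢-sym (∈H⇒≢x y∈H)) | dec-true (x ≟ x) refl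
                     | ∧-identityʳ (does (u ≟ y)) = refl

  deg⁺-unchanged : ∀ {z} → z ≢ x → z ≢ y → deg H⁺ z ≡ deg H z
  deg⁺-unchanged {z} z≢x z≢y = deg-cong {H = H⁺} {H′ = H} same
    where
      same : ∀ u → neighbourᵇ H⁺ z u ≡ neighbourᵇ H z u
      same u rewrite dec-false (z ≟ y) z≢y | dec-false (z ≟ x) z≢x | ∧-zeroʳ (does (u ≟ y))
                   | ∨-identityʳ (E H z u) | ∨-identityʳ (E H u z) = refl

  module _ (1<wy : 1 < w D y) where

    light⇒≢y : ∀ {z} → w D z ≡ 1 → z ≢ y
    light⇒≢y wz refl = <-irrefl (sym wz) 1<wy

    deg⁺-light : ∀ {z} → V H z ≡ true → w D z ≡ 1 → deg H⁺ z ≡ deg H z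
    deg⁺-light z∈H wz = deg⁺-unchanged (∈H⇒≢x z∈H) (light⇒≢y wz)

    RootTree⁺ : ∀ {v} → IsRootTree H v → IsRootTree H⁺ v
    RootTree⁺ {v} (acyclic , v∈H , paths , light) =
      (λ x₀ rest → acyclic x₀ rest ∘ CycleList⁺⇒CycleList) , cong (_∨ _) v∈H , paths⁺ , light⁺
      where
        reach-y : v ≡ y ⊎ Path (OArc H) v y
        reach-y with v ≟ y
        ... | yes v≡y = inj₁ v≡y
        ... | no v≢y  = inj₂ (paths y y∈H (≢-sym v≢y))

        paths⁺ : ∀ z → V⁺ z ≡ true → z ≢ v → Path (OArc H⁺) v z
        paths⁺ z z∈ z≢v with V⁺-cases z∈
        ... | inj₁ z∈H  = Path⁺ (paths z z∈H z≢v)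
        ... | inj₂ refl = Path⁺-to-x v∈H reach-y

        light⁺ : ∀ z → V⁺ z ≡ true → w D z ≡ 1 →
                 (deg H⁺ z ≡ 1 × z ≢ v) ⊎ ((∀ u → (V⁺ u ≡ true) ⇔ (u ≡ v)) × z ≡ v)
        light⁺ z z∈ wz with V⁺-cases z∈
        ... | inj₂ refl = inj₁ (deg⁺-x , ∈H⇒≢x v∈H ∘ sym)
        ... | inj₁ z∈H with light z z∈H wz
        ...   | inj₁ (deg≡1 , z≢v)   = inj₁ (trans (deg⁺-light z∈H wz) deg≡1 , z≢v)
        ...   | inj₂ (only-v , refl) = contradiction (sym (Equivalence.to (only-v y) y∈H)) (light⇒≢y wz)

    Unicycle⁺ : ∀ {C} → IsUnicycle H C → IsUnicycle H⁺ C
    Unicycle⁺ {C} (cycle , C⊆H , only-C , paths , light) =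
      cycle , ⊆ₛ-trans {H₁ = C} {H} {H⁺} C⊆H H⊆H⁺ ,
      (λ x₀ rest → only-C x₀ rest ∘ CycleList⁺⇒CycleList) , paths⁺ , light⁺
      where
        paths⁺ : ∀ z → V⁺ z ≡ true → V C z ≡ false →
                 Σ (Fin n) λ c → V C c ≡ true × Path (OArc H⁺) c z
        paths⁺ z z∈ z∉C with V⁺-cases z∈
        ... | inj₁ z∈H = map₂ (map₂ Path⁺) (paths z z∈H z∉C)
        ... | inj₂ refl with V C y in y∈C
        ...   | true  = y , y∈C , Path⁺-to-x y∈H (inj₁ refl)
        ...   | false with c , c∈C , p ← paths y y∈H y∈C =
          c , c∈C , Path⁺-to-x (proj₁ C⊆H c c∈C) (inj₂ p)

        light⁺ : ∀ z → V⁺ z ≡ true → w D z ≡ 1 → deg H⁺ z ≡ 1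
        light⁺ z z∈ wz with V⁺-cases z∈
        ... | inj₂ refl = deg⁺-x
        ... | inj₁ z∈H  = trans (deg⁺-light z∈H wz) (light z z∈H wz)

lemma3p8 : (n : ℕ) (D : WOG n) (K H : Sub D) →
    ((Σ (Fin n) λ v → MaxRootTreeIn K v H) ⊎ (Σ (Sub D) λ C → MaxUnicycleIn K C H)) →
    ¬ (Σ (Fin n) λ y → Σ (Fin n) λ x →
         E K y x ≡ true × V K x ≡ true × V H x ≡ false × 1 < w D y × V H y ≡ true)
lemma3p8 n D K H maximal (y , x , y→x∈K , _ , x∉H , 1<wy , y∈H) =
  ∈H⇒≢x (proj₁ (H⁺⊆H maximal) x x∈V⁺) refl
  where
    open PendantArc H (E⊆arc K y x y→x∈K) y∈H x∉H

    H⁺⊆H : (Σ (Fin n) λ v → MaxRootTreeIn K v H) ⊎ (Σ (Sub D) λ C → MaxUnicycleIn K C H) → H⁺ ⊆ₛ H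
    H⁺⊆H (inj₁ (_ , tree , H⊆K , max)) = max H⁺ (RootTree⁺ 1<wy tree) (H⁺⊆ K H⊆K y→x∈K) H⊆H⁺
    H⁺⊆H (inj₂ (C , uni  , H⊆K , max)) = max H⁺ (Unicycle⁺ 1<wy {C} uni) (H⁺⊆ K H⊆K y→x∈K) H⊆H⁺
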